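{- Let $k\ge 1$ be an integer and set \[A=\frac{xt}{1-\sum_{i=1}^k xt^i},\qquad B=\frac{yt}{1-\sum_{i=1}^k yt^i}.\] The generating function $\sum_{n\ge 0}P_{\textsc{EnSnort}(k),P_n}(x,y)\,t^n$ of the polynomial profiles of $\textsc{EnSnort}(k)$ played on paths equals \[\left(\frac{1}{1-t}\right)\left(\frac{1}{1-(A+B)\dfrac{t^k}{1-t}}\right)\left(\sum_{j=1}^k\frac{xt^j}{1-\sum_{i=1}^kxt^i}+\sum_{j=1}^k\frac{yt^j}{1-\sum_{i=1}^kyt^i}+1\right).\]
   Context: A distance game given by a pair of sets $(S,D)$ of positive integers is played on a finite graph by two players, Left (colouring vertices blue) and Right (colouring vertices red). A position is any assignment to a subset of the vertices of the colours blue or red (other vertices empty) such that no two vertices of the same colour are at graph distance in $S$ and no two vertices of different colours are at graph distance in $D$; no assumption of alternating play is made. $\textsc{EnSnort}(k)$ is the distance game with $S=\emptyset$ and $D=\{1,\dots,k\}$. The polynomial profile of a game $G$ on a board $B$ is $P_{G,B}(x,y)=\sum f_{j,l}x^jy^l$, where $f_{j,l}$ is the number of positions with exactly $j$ blue and $l$ red vertices. $P_n$ denotes the path with $n$ vertices; $P_0$ is the empty board, with profile $1$. -}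

module Defs where

open import Data.Bool using (Bool; true; false; not; _∧_; if_then_else_)
open import Data.Nat using (ℕ; zero; suc; _+_; _∸_; _≤ᵇ_; _<ᵇ_; _≡ᵇ_; ∣_-_∣)
open import Data.Fin using (Fin; toℕ)
open import Data.Vec using (Vec; []; _∷_; lookup)
open import Data.List using (List; []; _∷_; [_]; map; concatMap; allFin)
open import Data.Nat.ListAction using (sum)
open import Relation.Binary.PropositionalEquality using (_≡_)
open import Data.Integer using (ℤ; +_) renaming (_+_ to _+ℤ_; _*_ to _*ℤ_)

-- The vertices of P_n are Fin n; the graph distance of i and j is ∣ i - j ∣.
-- A set of positive integers is given by its Boolean characteristic function.

data Colour : Set where
  empty blue red : Colour

record DistanceGame : Set where
  field
    S : ℕ → Bool
    D : ℕ → Bool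
open DistanceGame public

pairOK : DistanceGame → ℕ → Colour → Colour → Bool
pairOK G d blue blue = not (S G d)
pairOK G d red  red  = not (S G d)
pairOK G d blue red  = not (D G d)
pairOK G d red  blue = not (D G d)
pairOK G d empty _   = true
pairOK G d blue empty = true
pairOK G d red  empty = true

allB : {A : Set} → (A → Bool) → List A → Bool
allB p []       = true
allB p (x ∷ xs) = p x ∧ allB p xs

-- an assignment of colours (empty = uncoloured) to the vertices of P_n is a
-- position iff every pair of distinct vertices satisfies the constraints
isPosition : DistanceGame → (n : ℕ) → Vec Colour n → Bool
isPosition G n v =
  allB (λ i → allB (λ j → if toℕ i <ᵇ toℕ j
                          then pairOK G ∣ toℕ i - toℕ j ∣ (lookup v i) (lookup v j)
                          else true)
                 (allFin n))
      (allFin n)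

allAssignments : (n : ℕ) → List (Vec Colour n)
allAssignments zero    = [ [] ]
allAssignments (suc n) =
  concatMap (λ c → map (c ∷_) (allAssignments n)) (empty ∷ blue ∷ red ∷ [])

isBlue : Colour → Bool
isBlue blue = true
isBlue _    = false

isRed : Colour → Bool
isRed red = true
isRed _   = false

countC : (Colour → Bool) → {n : ℕ} → Vec Colour n → ℕ
countC p []       = 0
countC p (c ∷ v)  = (if p c then 1 else 0) + countC p v

profileCoeff : DistanceGame → (n j l : ℕ) → ℕ
profileCoeff G n j l =
  sum (map (λ v → if isPosition G n v ∧ (countC isBlue v ≡ᵇ j) ∧ (countC isRed v ≡ᵇ l)
                    then 1 else 0)
           (allAssignments n))

EnSnort : ℕ → DistanceGame
EnSnort k = record { S = λ _ → false ; D = λ d → (1 ≤ᵇ d) ∧ (d ≤ᵇ k) }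

-- Formal power series in x, y, t with integer coefficients:
-- f a b c is the coefficient of x^a y^b t^c.

PS : Set
PS = ℕ → ℕ → ℕ → ℤ

infix 4 _≈_
_≈_ : PS → PS → Set
f ≈ g = ∀ a b c → f a b c ≡ g a b c

sumTo : ℕ → (ℕ → ℤ) → ℤ
sumTo zero    h = h 0
sumTo (suc n) h = sumTo n h +ℤ h (suc n)

zeroS oneS X Y T : PS
zeroS _ _ _ = + 0
oneS zero zero zero = + 1
oneS _ _ _ = + 0
X (suc zero) zero zero = + 1
X _ _ _ = + 0
Y zero (suc zero) zero = + 1
Y _ _ _ = + 0
T zero zero (suc zero) = + 1
T _ _ _ = + 0

infixl 6 _⊕_
infixl 7 _⊗_
infixr 8 _^S_

_⊕_ : PS → PS → PS
(f ⊕ g) a b c = f a b c +ℤ g a b c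

_⊗_ : PS → PS → PS
(f ⊗ g) a b c =
  sumTo a λ i → sumTo b λ j → sumTo c λ m → f i j m *ℤ g (a ∸ i) (b ∸ j) (c ∸ m)

_^S_ : PS → ℕ → PS
f ^S zero  = oneS
f ^S suc m = f ⊗ (f ^S m)

-- 1/(1-u) = Σ_{m ≥ 0} u^m, for u with zero constant term (then u^m has
-- total degree ≥ m, so the coefficient of x^a y^b t^c only receives
-- contributions from m ≤ a+b+c).  Used only for such u below.
geom : PS → PS
geom u a b c = sumTo (a + b + c) λ m → (u ^S m) a b c

sumS : ℕ → (ℕ → PS) → PS
sumS zero    h = zeroS
sumS (suc k) h = sumS k h ⊕ h (suc k)

profileGF : DistanceGame → PS
profileGF G a b c = + profileCoeff G c a b

denInv : ℕ → PS → PS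
denInv k z = geom (sumS k λ i → z ⊗ T ^S i)

A B : ℕ → PS
A k = X ⊗ T ⊗ denInv k X
B k = Y ⊗ T ⊗ denInv k Y

rhsGF : ℕ → PS
rhsGF k =
  geom T
  ⊗ geom ((A k ⊕ B k) ⊗ (T ^S k ⊗ geom T))
  ⊗ ( sumS k (λ j → X ⊗ T ^S j ⊗ denInv k X)
    ⊕ sumS k (λ j → Y ⊗ T ^S j ⊗ denInv k Y)
    ⊕ oneS )

{-# OPTIONS --safe #-}
module Submission where

-- Classify the positions on a path by their first vertex.  For a player p and d ≤ k let V p d
-- be the series of the positions that may follow a stone of p after k − d empty vertices, i.e.
-- whose first d vertices carry no stone of the opponent; V p 0 is the profile series.  Removing
-- the first vertex gives a linear system (FirstVertexEquations) in which every unknown on the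
-- right-hand side is multiplied by t, so the system has at most one solution.  It is solved in
-- closed form: unrolling V p (d+1) = 1 + t V p d + z t V p k expresses V p k through
-- 1/(1 − z(t + ⋯ + t^k)), after which rhsGF k satisfies the equation for V p 0.

open import Level using (0ℓ)
open import Data.Bool using (Bool; true; false; not; _∧_; if_then_else_)
open import Data.Bool.Properties using (∧-zeroʳ; ∧-identityʳ; ∧-assoc)
open import Data.Nat using (ℕ; zero; suc; _∸_; _≤_; _<_; z≤n; s≤s; _<?_; _≡ᵇ_; _<ᵇ_; ∣_-_∣)
  renaming (_+_ to _+ℕ_)
import Data.Nat.Properties as ℕₚ
open import Data.Nat.Induction using (<-rec)
open import Data.Nat.ListAction using (sum)
open import Data.Nat.ListAction.Properties using (sum-++)
open import Data.Integer using (ℤ; +_) renaming (_+_ to _+ℤ_; _*_ to _*ℤ_)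
import Data.Integer.Properties as ℤₚ
open import Data.Fin using (Fin; toℕ) renaming (zero to fzero; suc to fsuc)
open import Data.Vec using (Vec; []; _∷_; lookup)
open import Data.List using ([]; _∷_; map; _++_; tabulate)
open import Data.List.Properties using (map-++; map-∘; map-cong)
open import Data.Sum using (inj₁; inj₂)
open import Data.Product using (_,_)
open import Relation.Nullary using (yes; no)
open import Relation.Binary.PropositionalEquality as ≡ using (_≡_; cong; cong₂)
open import Algebra.Bundles using (CommutativeSemiring)
open import Algebra.Structures.Biased using (isCommutativeSemiringˡ)
import Algebra.Properties.CommutativeSemigroup as CommutativeSemigroupProperties
import Algebra.Construct.Pointwise as Pointwise
import Algebra.Solver.Ring.NaturalCoefficients.Default as NaturalCoefficientsSolver
import Relation.Binary.Reasoning.Setoid as SetoidReasoning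

-- Finite sums and Cauchy products

module FiniteSum (R : CommutativeSemiring 0ℓ 0ℓ) where
  open CommutativeSemiring R
  open CommutativeSemigroupProperties +-commutativeSemigroup using (interchange)
  open SetoidReasoning setoid

  ∑ : ℕ → (ℕ → Carrier) → Carrier
  ∑ zero    f = f 0
  ∑ (suc n) f = ∑ n f + f (suc n)

  ∑-cong : ∀ n {f g} → (∀ i → i ≤ n → f i ≈ g i) → ∑ n f ≈ ∑ n g
  ∑-cong zero    f≈g = f≈g 0 z≤n
  ∑-cong (suc n) f≈g =
    +-cong (∑-cong n (λ i i≤n → f≈g i (ℕₚ.m≤n⇒m≤1+n i≤n))) (f≈g (suc n) ℕₚ.≤-refl)

  ∑-zero : ∀ n {f} → (∀ i → i ≤ n → f i ≈ 0#) → ∑ n f ≈ 0#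
  ∑-zero zero    f≈0 = f≈0 0 z≤n
  ∑-zero (suc n) f≈0 =
    trans (+-cong (∑-zero n (λ i i≤n → f≈0 i (ℕₚ.m≤n⇒m≤1+n i≤n))) (f≈0 (suc n) ℕₚ.≤-refl))
          (+-identityˡ 0#)

  ∑-distrib-+ : ∀ n f g → ∑ n (λ i → f i + g i) ≈ ∑ n f + ∑ n g
  ∑-distrib-+ zero    f g = refl
  ∑-distrib-+ (suc n) f g = trans (+-cong (∑-distrib-+ n f g) refl) (interchange _ _ _ _)

  *-distribˡ-∑ : ∀ n x f → x * ∑ n f ≈ ∑ n (λ i → x * f i)
  *-distribˡ-∑ zero    x f = refl
  *-distribˡ-∑ (suc n) x f = trans (distribˡ x _ _) (+-cong (*-distribˡ-∑ n x f) refl)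

  *-distribʳ-∑ : ∀ n x f → ∑ n f * x ≈ ∑ n (λ i → f i * x)
  *-distribʳ-∑ zero    x f = refl
  *-distribʳ-∑ (suc n) x f = trans (distribʳ x _ _) (+-cong (*-distribʳ-∑ n x f) refl)

  ∑-unfoldˡ : ∀ n f → ∑ (suc n) f ≈ f 0 + ∑ n (λ i → f (suc i))
  ∑-unfoldˡ zero    f = refl
  ∑-unfoldˡ (suc n) f = trans (+-cong (∑-unfoldˡ n f) refl) (+-assoc _ _ _)

  ∑-reverse : ∀ n f → ∑ n f ≈ ∑ n (λ i → f (n ∸ i))
  ∑-reverse zero    f = refl
  ∑-reverse (suc n) f =
    trans (+-comm _ _) (trans (+-cong refl (∑-reverse n f)) (sym (∑-unfoldˡ n (λ i → f (suc n ∸ i)))))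

  ∑-truncate : ∀ {c} N f → c ≤ N → (∀ i → c < i → f i ≈ 0#) → ∑ N f ≈ ∑ c f
  ∑-truncate zero    f z≤n f≈0 = refl
  ∑-truncate (suc N) f c≤1+N f≈0 with ℕₚ.m≤n⇒m<n∨m≡n c≤1+N
  ... | inj₂ ≡.refl       = refl
  ... | inj₁ (s≤s c≤N) =
    trans (+-cong (∑-truncate N f c≤N f≈0) (f≈0 (suc N) (s≤s c≤N))) (+-identityʳ _)

  ∑-triangle : ∀ n (F : ℕ → ℕ → Carrier) →
               ∑ n (λ i → ∑ i (λ j → F j i)) ≈ ∑ n (λ j → ∑ (n ∸ j) (λ p → F j (j +ℕ p)))
  ∑-triangle zero    F = refl
  ∑-triangle (suc n) F = sym (begin
      ∑ n (λ j → ∑ (suc n ∸ j) (λ p → F j (j +ℕ p))) + ∑ (n ∸ n) (λ p → F (suc n) (suc n +ℕ p))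
    ≈⟨ +-cong (∑-cong n lastColumn) lastRow ⟩
      ∑ n (λ j → ∑ (n ∸ j) (λ p → F j (j +ℕ p)) + F j (suc n)) + F (suc n) (suc n)
    ≈⟨ trans (+-cong (∑-distrib-+ n _ _) refl) (+-assoc _ _ _) ⟩
      ∑ n (λ j → ∑ (n ∸ j) (λ p → F j (j +ℕ p))) + (∑ n (λ j → F j (suc n)) + F (suc n) (suc n))
    ≈⟨ +-cong (sym (∑-triangle n F)) refl ⟩
      ∑ n (λ i → ∑ i (λ j → F j i)) + ∑ (suc n) (λ j → F j (suc n))
    ∎)
    where
    lastColumn : ∀ j → j ≤ n →
                 ∑ (suc n ∸ j) (λ p → F j (j +ℕ p)) ≈ ∑ (n ∸ j) (λ p → F j (j +ℕ p)) + F j (suc n)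
    lastColumn j j≤n rewrite ℕₚ.+-∸-assoc 1 j≤n =
      +-cong refl (reflexive (cong (F j) (≡.trans (ℕₚ.+-suc j (n ∸ j)) (cong suc (ℕₚ.m+[n∸m]≡n j≤n)))))
    lastRow : ∑ (n ∸ n) (λ p → F (suc n) (suc n +ℕ p)) ≈ F (suc n) (suc n)
    lastRow rewrite ℕₚ.n∸n≡0 n | ℕₚ.+-identityʳ (suc n) = refl

module CauchyProduct (R : CommutativeSemiring 0ℓ 0ℓ) where
  open CommutativeSemiring R renaming (_≈_ to _≈ᴿ_)
  open FiniteSum R
  open SetoidReasoning setoid

  Seq : Set
  Seq = ℕ → Carrier

  infix 4 _≋_
  _≋_ : Seq → Seq → Set
  f ≋ g = ∀ n → f n ≈ᴿ g n

  infixl 6 _⊞_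
  infixl 7 _⊠_

  _⊞_ : Seq → Seq → Seq
  (f ⊞ g) n = f n + g n

  _⊠_ : Seq → Seq → Seq
  (f ⊠ g) n = ∑ n (λ i → f i * g (n ∸ i))

  constant : Carrier → Seq
  constant x zero    = x
  constant x (suc _) = 0#

  shift : Seq → Seq
  shift f zero    = 0#
  shift f (suc n) = f n

  𝟘 𝟙 : Seq
  𝟘 _ = 0#
  𝟙   = constant 1#

  ⊠-cong : ∀ {f f′ g g′} → f ≋ f′ → g ≋ g′ → f ⊠ g ≋ f′ ⊠ g′
  ⊠-cong f≋f′ g≋g′ n = ∑-cong n (λ i _ → *-cong (f≋f′ i) (g≋g′ (n ∸ i)))

  ⊠-comm : ∀ f g → f ⊠ g ≋ g ⊠ f
  ⊠-comm f g n = trans (∑-reverse n _)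
    (∑-cong n (λ i i≤n → trans (*-cong refl (reflexive (cong g (ℕₚ.m∸[m∸n]≡n i≤n)))) (*-comm _ _)))

  ⊠-assoc : ∀ f g h → (f ⊠ g) ⊠ h ≋ f ⊠ (g ⊠ h)
  ⊠-assoc f g h n = begin
      ∑ n (λ i → ∑ i (λ j → f j * g (i ∸ j)) * h (n ∸ i))
    ≈⟨ ∑-cong n (λ i _ → *-distribʳ-∑ i _ _) ⟩
      ∑ n (λ i → ∑ i (λ j → (f j * g (i ∸ j)) * h (n ∸ i)))
    ≈⟨ ∑-triangle n (λ j i → (f j * g (i ∸ j)) * h (n ∸ i)) ⟩
      ∑ n (λ j → ∑ (n ∸ j) (λ p → (f j * g (j +ℕ p ∸ j)) * h (n ∸ (j +ℕ p))))
    ≈⟨ ∑-cong n (λ j _ → ∑-cong (n ∸ j) (λ p _ → reindex j p)) ⟩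
      ∑ n (λ j → ∑ (n ∸ j) (λ p → f j * (g p * h (n ∸ j ∸ p))))
    ≈⟨ ∑-cong n (λ j _ → sym (*-distribˡ-∑ (n ∸ j) _ _)) ⟩
      ∑ n (λ j → f j * ∑ (n ∸ j) (λ p → g p * h (n ∸ j ∸ p)))
    ∎
    where
    reindex : ∀ j p → (f j * g (j +ℕ p ∸ j)) * h (n ∸ (j +ℕ p)) ≈ᴿ f j * (g p * h (n ∸ j ∸ p))
    reindex j p rewrite ℕₚ.m+n∸m≡n j p | ℕₚ.∸-+-assoc n j p = *-assoc _ _ _

  ⊠-constantˡ : ∀ x f n → (constant x ⊠ f) n ≈ᴿ x * f n
  ⊠-constantˡ x f zero    = refl
  ⊠-constantˡ x f (suc n) = begin
      (constant x ⊠ f) (suc n)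
    ≈⟨ ∑-unfoldˡ n _ ⟩
      x * f (suc n) + ∑ n (λ i → 0# * f (n ∸ i))
    ≈⟨ +-cong refl (∑-zero n (λ i _ → zeroˡ _)) ⟩
      x * f (suc n) + 0#
    ≈⟨ +-identityʳ _ ⟩
      x * f (suc n)
    ∎

  ⊠-identityˡ : ∀ f → 𝟙 ⊠ f ≋ f
  ⊠-identityˡ f n = trans (⊠-constantˡ 1# f n) (*-identityˡ (f n))

  shift-cong : ∀ {f g} → f ≋ g → shift f ≋ shift g
  shift-cong f≋g zero    = refl
  shift-cong f≋g (suc n) = f≋g n

  ⊠-shiftˡ : ∀ f g → shift f ⊠ g ≋ shift (f ⊠ g)
  ⊠-shiftˡ f g zero    = zeroˡ (g 0)
  ⊠-shiftˡ f g (suc n) = trans (∑-unfoldˡ n _) (trans (+-cong (zeroˡ _) refl) (+-identityˡ _))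

  seqSemiring : CommutativeSemiring 0ℓ 0ℓ
  seqSemiring = record
    { Carrier = Seq
    ; _≈_     = _≋_
    ; _+_     = _⊞_
    ; _*_     = _⊠_
    ; 0#      = 𝟘
    ; 1#      = 𝟙
    ; isCommutativeSemiring = isCommutativeSemiringˡ record
      { +-isCommutativeMonoid = Pointwise.isCommutativeMonoid ℕ +-isCommutativeMonoid
      ; *-isCommutativeMonoid = record
        { isMonoid = record
          { isSemigroup = record
            { isMagma = record { isEquivalence = Pointwise.isEquivalence ℕ isEquivalence ; ∙-cong = ⊠-cong }
            ; assoc   = ⊠-assoc }
          ; identity = ⊠-identityˡ , (λ f n → trans (⊠-comm f 𝟙 n) (⊠-identityˡ f n)) }
        ; comm = ⊠-comm }
      ; distribʳ = λ h f g n → trans (∑-cong n (λ i _ → distribʳ _ _ _)) (∑-distrib-+ n _ _)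
      ; zeroˡ    = λ f n → ∑-zero n (λ i _ → zeroˡ _)
      }
    }

  open FiniteSum seqSemiring public using () renaming (∑ to ∑ˢ)

  ∑ˢ-apply : ∀ n F i → ∑ˢ n F i ≡ ∑ n (λ m → F m i)
  ∑ˢ-apply zero    F i = ≡.refl
  ∑ˢ-apply (suc n) F i = cong (_+ F (suc n) i) (∑ˢ-apply n F i)

-- Power series in x, y and t

open import Defs

module ℤ∑ = FiniteSum ℤₚ.+-*-commutativeSemiring

-- PS is ℤ⟦t⟧⟦y⟧⟦x⟧: in f a b c the outermost index a is the degree in x.
module ℤ⟦t⟧   = CauchyProduct ℤₚ.+-*-commutativeSemiring
module ℤ⟦y,t⟧  = CauchyProduct ℤ⟦t⟧.seqSemiring
module ℤ⟦x,y,t⟧ = CauchyProduct ℤ⟦y,t⟧.seqSemiring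

sumTo≡∑ : ∀ n f → sumTo n f ≡ ℤ∑.∑ n f
sumTo≡∑ zero    f = ≡.refl
sumTo≡∑ (suc n) f = cong (_+ℤ f (suc n)) (sumTo≡∑ n f)

sumTo-cong : ∀ n {f g} → (∀ i → i ≤ n → f i ≡ g i) → sumTo n f ≡ sumTo n g
sumTo-cong n {f} {g} f≡g = ≡.trans (sumTo≡∑ n f) (≡.trans (ℤ∑.∑-cong n f≡g) (≡.sym (sumTo≡∑ n g)))

sumTo-zero : ∀ n {f} → (∀ i → i ≤ n → f i ≡ + 0) → sumTo n f ≡ + 0
sumTo-zero n {f} f≡0 = ≡.trans (sumTo≡∑ n f) (ℤ∑.∑-zero n f≡0)

sumTo-unfoldˡ : ∀ n f → sumTo (suc n) f ≡ f 0 +ℤ sumTo n (λ i → f (suc i))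
sumTo-unfoldˡ n f =
  ≡.trans (sumTo≡∑ (suc n) f) (≡.trans (ℤ∑.∑-unfoldˡ n f) (cong (f 0 +ℤ_) (≡.sym (sumTo≡∑ n _))))

sumTo-truncate : ∀ {c} N f → c ≤ N → (∀ i → c < i → f i ≡ + 0) → sumTo N f ≡ sumTo c f
sumTo-truncate {c} N f c≤N f≡0 =
  ≡.trans (sumTo≡∑ N f) (≡.trans (ℤ∑.∑-truncate N f c≤N f≡0) (≡.sym (sumTo≡∑ c f)))

⊗-coeff : ∀ f g a b c →
  (f ⊗ g) a b c ≡
  ℤ∑.∑ a (λ i → ℤ∑.∑ b (λ j → ℤ∑.∑ c (λ m → f i j m *ℤ g (a ∸ i) (b ∸ j) (c ∸ m))))
⊗-coeff f g a b c =
  ≡.trans (sumTo≡∑ a _) (ℤ∑.∑-cong a (λ i _ →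
    ≡.trans (sumTo≡∑ b _) (ℤ∑.∑-cong b (λ j _ → sumTo≡∑ c _))))

⊠-coeff : ∀ f g a b c →
  ℤ⟦x,y,t⟧._⊠_ f g a b c ≡
  ℤ∑.∑ a (λ i → ℤ∑.∑ b (λ j → ℤ∑.∑ c (λ m → f i j m *ℤ g (a ∸ i) (b ∸ j) (c ∸ m))))
⊠-coeff f g a b c = begin
    ℤ⟦x,y,t⟧._⊠_ f g a b c
  ≡⟨ cong (λ h → h c) (ℤ⟦y,t⟧.∑ˢ-apply a (λ i → f i ℤ⟦y,t⟧.⊠ g (a ∸ i)) b) ⟩
    ℤ⟦t⟧.∑ˢ a (λ i → (f i ℤ⟦y,t⟧.⊠ g (a ∸ i)) b) c
  ≡⟨ ℤ⟦t⟧.∑ˢ-apply a _ c ⟩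
    ℤ∑.∑ a (λ i → (f i ℤ⟦y,t⟧.⊠ g (a ∸ i)) b c)
  ≡⟨ ℤ∑.∑-cong a (λ i _ → ℤ⟦t⟧.∑ˢ-apply b _ c) ⟩
    ℤ∑.∑ a (λ i → ℤ∑.∑ b (λ j → ℤ∑.∑ c (λ m → f i j m *ℤ g (a ∸ i) (b ∸ j) (c ∸ m))))
  ∎
  where open ≡.≡-Reasoning

⊗≈⊠ : ∀ f g → f ⊗ g ≈ ℤ⟦x,y,t⟧._⊠_ f g
⊗≈⊠ f g a b c = ≡.trans (⊗-coeff f g a b c) (≡.sym (⊠-coeff f g a b c))

module ℤ⟦x,y,t⟧ₛ = CommutativeSemiring ℤ⟦x,y,t⟧.seqSemiring
module ℤ⟦y,t⟧ₛ  = CommutativeSemiring ℤ⟦y,t⟧.seqSemiring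
module ℤ⟦t⟧ₛ    = CommutativeSemiring ℤ⟦t⟧.seqSemiring

oneS≈𝟙 : oneS ≈ ℤ⟦x,y,t⟧.𝟙
oneS≈𝟙 zero    zero    zero    = ≡.refl
oneS≈𝟙 zero    zero    (suc c) = ≡.refl
oneS≈𝟙 zero    (suc b) c       = ≡.refl
oneS≈𝟙 (suc a) b       c       = ≡.refl

psSemiring : CommutativeSemiring 0ℓ 0ℓ
psSemiring = record
  { Carrier = PS
  ; _≈_     = _≈_
  ; _+_     = _⊕_
  ; _*_     = _⊗_
  ; 0#      = zeroS
  ; 1#      = oneS
  ; isCommutativeSemiring = isCommutativeSemiringˡ record
    { +-isCommutativeMonoid = ℤ⟦x,y,t⟧ₛ.+-isCommutativeMonoid
    ; *-isCommutativeMonoid = record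
      { isMonoid = record
        { isSemigroup = record
          { isMagma = record { isEquivalence = ℤ⟦x,y,t⟧ₛ.isEquivalence ; ∙-cong = ⊗-cong }
          ; assoc   = ⊗-assoc }
        ; identity = ⊗-identityˡ , λ f → trans (⊗-comm f oneS) (⊗-identityˡ f) }
      ; comm = ⊗-comm }
    ; distribʳ = λ h f g → trans (⊗≈⊠ (f ⊕ g) h)
                   (trans (ℤ⟦x,y,t⟧ₛ.distribʳ h f g)
                          (sym (ℤ⟦x,y,t⟧ₛ.+-cong (⊗≈⊠ f h) (⊗≈⊠ g h))))
    ; zeroˡ    = λ f → trans (⊗≈⊠ zeroS f) (ℤ⟦x,y,t⟧ₛ.zeroˡ f)
    }
  }
  where
  open ℤ⟦x,y,t⟧ₛ using (sym; trans)

  ⊗-cong : ∀ {f f′ g g′} → f ≈ f′ → g ≈ g′ → f ⊗ g ≈ f′ ⊗ g′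
  ⊗-cong {f} {f′} {g} {g′} f≈f′ g≈g′ =
    trans (⊗≈⊠ f g) (trans (ℤ⟦x,y,t⟧ₛ.*-cong f≈f′ g≈g′) (sym (⊗≈⊠ f′ g′)))

  ⊗-assoc : ∀ f g h → (f ⊗ g) ⊗ h ≈ f ⊗ (g ⊗ h)
  ⊗-assoc f g h =
    trans (⊗≈⊠ (f ⊗ g) h) (trans (ℤ⟦x,y,t⟧ₛ.*-cong (⊗≈⊠ f g) (ℤ⟦x,y,t⟧ₛ.refl {h}))
    (trans (ℤ⟦x,y,t⟧ₛ.*-assoc f g h)
    (sym (trans (⊗≈⊠ f (g ⊗ h)) (ℤ⟦x,y,t⟧ₛ.*-cong (ℤ⟦x,y,t⟧ₛ.refl {f}) (⊗≈⊠ g h))))))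

  ⊗-comm : ∀ f g → f ⊗ g ≈ g ⊗ f
  ⊗-comm f g = trans (⊗≈⊠ f g) (trans (ℤ⟦x,y,t⟧ₛ.*-comm f g) (sym (⊗≈⊠ g f)))

  ⊗-identityˡ : ∀ f → oneS ⊗ f ≈ f
  ⊗-identityˡ f =
    trans (⊗≈⊠ oneS f)
          (trans (ℤ⟦x,y,t⟧ₛ.*-cong oneS≈𝟙 (ℤ⟦x,y,t⟧ₛ.refl {f})) (ℤ⟦x,y,t⟧ₛ.*-identityˡ f))

open CommutativeSemiring psSemiring
  using (setoid; +-cong; *-cong; +-assoc; zeroˡ)
  renaming (refl to ≈-refl; sym to ≈-sym; trans to ≈-trans)
open NaturalCoefficientsSolver psSemiring using (solve; _:=_; con; _:+_; _:*_)

xShift yShift tShift : PS → PS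
xShift f     = ℤ⟦x,y,t⟧.shift f
yShift f a   = ℤ⟦y,t⟧.shift (f a)
tShift f a b = ℤ⟦t⟧.shift (f a b)

X-⊗ : ∀ f → X ⊗ f ≈ xShift f
X-⊗ f = begin
    X ⊗ f                                       ≈⟨ ⊗≈⊠ X f ⟩
    X ⊠ f                                       ≈⟨ ⊠-cong X≈ (ℤ⟦x,y,t⟧ₛ.refl {f}) ⟩
    shift 𝟙 ⊠ f                                 ≈⟨ ⊠-shiftˡ 𝟙 f ⟩
    shift (𝟙 ⊠ f)                               ≈⟨ shift-cong (⊠-identityˡ f) ⟩
    shift f                                     ∎
  where
  open ℤ⟦x,y,t⟧
  open SetoidReasoning ℤ⟦x,y,t⟧ₛ.setoid
  X≈ : X ≈ shift 𝟙
  X≈ zero          b       c       = ≡.refl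
  X≈ (suc zero)    zero    zero    = ≡.refl
  X≈ (suc zero)    zero    (suc c) = ≡.refl
  X≈ (suc zero)    (suc b) c       = ≡.refl
  X≈ (suc (suc a)) b       c       = ≡.refl

Y-⊗ : ∀ f → Y ⊗ f ≈ yShift f
Y-⊗ f a = begin
    (Y ⊗ f) a                                     ≈⟨ ⊗≈⊠ Y f a ⟩
    (Y ⊠₃ f) a                                    ≈⟨ ⊠₃-cong Y≈ (ℤ⟦x,y,t⟧ₛ.refl {f}) a ⟩
    (constant₃ (shift 𝟙) ⊠₃ f) a                  ≈⟨ ⊠₃-constantˡ (shift 𝟙) f a ⟩
    shift 𝟙 ⊠ f a                                 ≈⟨ ⊠-shiftˡ 𝟙 (f a) ⟩
    shift (𝟙 ⊠ f a)                               ≈⟨ shift-cong (⊠-identityˡ (f a)) ⟩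
    shift (f a)                                   ∎
  where
  open ℤ⟦y,t⟧
  open ℤ⟦x,y,t⟧ using () renaming (_⊠_ to _⊠₃_; ⊠-cong to ⊠₃-cong; constant to constant₃;
                                    ⊠-constantˡ to ⊠₃-constantˡ)
  open SetoidReasoning ℤ⟦y,t⟧ₛ.setoid
  Y≈ : Y ≈ constant₃ (shift 𝟙)
  Y≈ zero    zero          c       = ≡.refl
  Y≈ zero    (suc zero)    zero    = ≡.refl
  Y≈ zero    (suc zero)    (suc c) = ≡.refl
  Y≈ zero    (suc (suc b)) c       = ≡.refl
  Y≈ (suc a) b             c       = ≡.refl

T-⊗ : ∀ f → T ⊗ f ≈ tShift f
T-⊗ f a b = begin
    (T ⊗ f) a b                                   ≈⟨ ⊗≈⊠ T f a b ⟩
    (T ⊠₃ f) a b                                  ≈⟨ ⊠₃-cong T≈ (ℤ⟦x,y,t⟧ₛ.refl {f}) a b ⟩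
    (constant₃ (constant₂ (shift 𝟙)) ⊠₃ f) a b    ≈⟨ ⊠₃-constantˡ (constant₂ (shift 𝟙)) f a b ⟩
    (constant₂ (shift 𝟙) ⊠₂ f a) b                ≈⟨ ⊠₂-constantˡ (shift 𝟙) (f a) b ⟩
    shift 𝟙 ⊠ f a b                               ≈⟨ ⊠-shiftˡ 𝟙 (f a b) ⟩
    shift (𝟙 ⊠ f a b)                             ≈⟨ shift-cong (⊠-identityˡ (f a b)) ⟩
    shift (f a b)                                 ∎
  where
  open ℤ⟦t⟧
  open ℤ⟦y,t⟧ using () renaming (_⊠_ to _⊠₂_; constant to constant₂; ⊠-constantˡ to ⊠₂-constantˡ)
  open ℤ⟦x,y,t⟧ using () renaming (_⊠_ to _⊠₃_; ⊠-cong to ⊠₃-cong; constant to constant₃;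
                                    ⊠-constantˡ to ⊠₃-constantˡ)
  open SetoidReasoning ℤ⟦t⟧ₛ.setoid
  T≈ : T ≈ constant₃ (constant₂ (shift 𝟙))
  T≈ zero    zero    zero          = ≡.refl
  T≈ zero    zero    (suc zero)    = ≡.refl
  T≈ zero    zero    (suc (suc c)) = ≡.refl
  T≈ zero    (suc b) c             = ≡.refl
  T≈ (suc a) b       c             = ≡.refl

⊕-congˡ : ∀ f {g g′} → g ≈ g′ → f ⊕ g ≈ f ⊕ g′
⊕-congˡ f = +-cong (≈-refl {f})

⊕-congʳ : ∀ {f f′} g → f ≈ f′ → f ⊕ g ≈ f′ ⊕ g
⊕-congʳ g f≈f′ = +-cong f≈f′ (≈-refl {g})

⊗-congˡ : ∀ f {g g′} → g ≈ g′ → f ⊗ g ≈ f ⊗ g′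
⊗-congˡ f = *-cong (≈-refl {f})

⊗-congʳ : ∀ {f f′} g → f ≈ f′ → f ⊗ g ≈ f′ ⊗ g
⊗-congʳ g f≈f′ = *-cong f≈f′ (≈-refl {g})

-- Divisibility by t and geometric series

infix 4 t^_∣_
t^_∣_ : ℕ → PS → Set
t^ n ∣ u = ∀ a b c → c < n → u a b c ≡ + 0

t^0∣ : ∀ u → t^ 0 ∣ u
t^0∣ u a b c ()

t∣T : t^ 1 ∣ T
t∣T zero    zero    zero (s≤s z≤n) = ≡.refl
t∣T zero    (suc b) zero (s≤s z≤n) = ≡.refl
t∣T (suc a) b       zero (s≤s z≤n) = ≡.refl

∣-⊕ : ∀ {n u v} → t^ n ∣ u → t^ n ∣ v → t^ n ∣ u ⊕ v
∣-⊕ u∣ v∣ a b c c<n = cong₂ _+ℤ_ (u∣ a b c c<n) (v∣ a b c c<n)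

∣-⊗ : ∀ {m n u v} → t^ m ∣ u → t^ n ∣ v → t^ (m +ℕ n) ∣ u ⊗ v
∣-⊗ {m} {n} {u} {v} u∣ v∣ a b c c<m+n =
  sumTo-zero a (λ i _ → sumTo-zero b (λ j _ → sumTo-zero c (λ l l≤c → term i j l l≤c)))
  where
  term : ∀ i j l → l ≤ c → u i j l *ℤ v (a ∸ i) (b ∸ j) (c ∸ l) ≡ + 0
  term i j l l≤c with l <? m
  ... | yes l<m = cong (_*ℤ v (a ∸ i) (b ∸ j) (c ∸ l)) (u∣ i j l l<m)
  ... | no  l≮m = ≡.trans (cong (u i j l *ℤ_) (v∣ _ _ _ c∸l<n)) (ℤₚ.*-zeroʳ (u i j l))
    where
    c∸l<n : c ∸ l < n
    c∸l<n = ≡.subst (c ∸ l <_) (ℕₚ.m+n∸m≡n l n)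
              (ℕₚ.∸-monoˡ-< (ℕₚ.<-≤-trans c<m+n (ℕₚ.+-monoˡ-≤ n (ℕₚ.≮⇒≥ l≮m))) l≤c)

∣-^S : ∀ {u} m → t^ 1 ∣ u → t^ m ∣ u ^S m
∣-^S zero    u∣ = t^0∣ oneS
∣-^S (suc m) u∣ = ∣-⊗ u∣ (∣-^S m u∣)

module ∑ᴾ = FiniteSum psSemiring

∑ᴾ-coeff : ∀ n F a b c → ∑ᴾ.∑ n F a b c ≡ sumTo n (λ m → F m a b c)
∑ᴾ-coeff zero    F a b c = ≡.refl
∑ᴾ-coeff (suc n) F a b c = cong (_+ℤ F (suc n) a b c) (∑ᴾ-coeff n F a b c)

⊗-congʳ-upTo : ∀ f {g g′} c → (∀ a b c′ → c′ ≤ c → g a b c′ ≡ g′ a b c′) →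
               ∀ a b → (f ⊗ g) a b c ≡ (f ⊗ g′) a b c
⊗-congʳ-upTo f c g≡g′ a b =
  sumTo-cong a (λ i _ → sumTo-cong b (λ j _ → sumTo-cong c (λ l _ →
    cong (f i j l *ℤ_) (g≡g′ (a ∸ i) (b ∸ j) (c ∸ l) (ℕₚ.m∸n≤m c l)))))

geom-truncate : ∀ {u} → t^ 1 ∣ u → ∀ N a b c → c ≤ N → geom u a b c ≡ sumTo N (λ m → (u ^S m) a b c)
geom-truncate {u} u∣ N a b c c≤N =
  ≡.trans (sumTo-truncate (a +ℕ b +ℕ c) _ (ℕₚ.m≤n+m c (a +ℕ b)) vanish)
          (≡.sym (sumTo-truncate N _ c≤N vanish))
  where
  vanish : ∀ m → c < m → (u ^S m) a b c ≡ + 0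
  vanish m = ∣-^S m u∣ a b c

geom-unfold : ∀ {u} → t^ 1 ∣ u → geom u ≈ oneS ⊕ u ⊗ geom u
geom-unfold {u} u∣ a b c = begin
    geom u a b c
  ≡⟨ geom-truncate u∣ (suc c) a b c (ℕₚ.n≤1+n c) ⟩
    sumTo (suc c) (λ m → (u ^S m) a b c)
  ≡⟨ sumTo-unfoldˡ c _ ⟩
    oneS a b c +ℤ sumTo c (λ m → (u ⊗ u ^S m) a b c)
  ≡⟨ cong (oneS a b c +ℤ_)
       (≡.sym (≡.trans (∑ᴾ.*-distribˡ-∑ c u (u ^S_) a b c) (∑ᴾ-coeff c _ a b c))) ⟩
    oneS a b c +ℤ (u ⊗ ∑ᴾ.∑ c (u ^S_)) a b c
  ≡⟨ cong (oneS a b c +ℤ_) (⊗-congʳ-upTo u c powers≡geom a b) ⟩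
    oneS a b c +ℤ (u ⊗ geom u) a b c
  ∎
  where
  open ≡.≡-Reasoning
  powers≡geom : ∀ a b c′ → c′ ≤ c → ∑ᴾ.∑ c (u ^S_) a b c′ ≡ geom u a b c′
  powers≡geom a b c′ c′≤c = ≡.trans (∑ᴾ-coeff c _ a b c′) (≡.sym (geom-truncate u∣ c a b c′ c′≤c))

-- The first-vertex equations

data Player : Set where
  Left Right : Player

stoneVar : Player → PS
stoneVar Left  = X
stoneVar Right = Y

record FirstVertexEquations (k : ℕ) (V : Player → ℕ → PS) : Set where
  field
    start : ∀ p → V p 0 ≈ oneS ⊕ T ⊗ V p 0 ⊕ X ⊗ (T ⊗ V Left k) ⊕ Y ⊗ (T ⊗ V Right k)
    step  : ∀ p d → d < k → V p (suc d) ≈ oneS ⊕ T ⊗ V p d ⊕ stoneVar p ⊗ (T ⊗ V p k)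

record AgreeAt (c : ℕ) (f g : PS) : Set where
  constructor agreeAt
  field coeff≡ : ∀ a b → f a b c ≡ g a b c
open AgreeAt

agreeAt-refl : ∀ {c} f → AgreeAt c f f
agreeAt-refl f = agreeAt λ _ _ → ≡.refl

agreeAt-⊕ : ∀ {c f f′ g g′} → AgreeAt c f g → AgreeAt c f′ g′ → AgreeAt c (f ⊕ f′) (g ⊕ g′)
agreeAt-⊕ (agreeAt f≡g) (agreeAt f′≡g′) = agreeAt λ a b → cong₂ _+ℤ_ (f≡g a b) (f′≡g′ a b)

agreeAt-T⊗ : ∀ {c f g} → (∀ {c′} → c′ < c → AgreeAt c′ f g) → AgreeAt c (T ⊗ f) (T ⊗ g)
agreeAt-T⊗ {zero}  {f} {g} _     = agreeAt λ a b → ≡.trans (T-⊗ f a b 0) (≡.sym (T-⊗ g a b 0))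
agreeAt-T⊗ {suc c} {f} {g} below = agreeAt λ a b →
  ≡.trans (T-⊗ f a b (suc c)) (≡.trans (coeff≡ (below ℕₚ.≤-refl) a b) (≡.sym (T-⊗ g a b (suc c))))

agreeAt-stoneVar⊗ : ∀ p {c f g} → AgreeAt c f g → AgreeAt c (stoneVar p ⊗ f) (stoneVar p ⊗ g)
agreeAt-stoneVar⊗ Left  {c} {f} {g} (agreeAt f≡g) = agreeAt λ where
  zero    b → ≡.trans (X-⊗ f 0 b c) (≡.sym (X-⊗ g 0 b c))
  (suc a) b → ≡.trans (X-⊗ f (suc a) b c) (≡.trans (f≡g a b) (≡.sym (X-⊗ g (suc a) b c)))
agreeAt-stoneVar⊗ Right {c} {f} {g} (agreeAt f≡g) = agreeAt λ where
  a zero    → ≡.trans (Y-⊗ f a 0 c) (≡.sym (Y-⊗ g a 0 c))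
  a (suc b) → ≡.trans (Y-⊗ f a (suc b) c) (≡.trans (f≡g a b) (≡.sym (Y-⊗ g a (suc b) c)))

agreeAt-≈ : ∀ {c f f′ g g′} → f ≈ f′ → g ≈ g′ → AgreeAt c f′ g′ → AgreeAt c f g
agreeAt-≈ {c} f≈f′ g≈g′ (agreeAt f′≡g′) =
  agreeAt λ a b → ≡.trans (f≈f′ a b c) (≡.trans (f′≡g′ a b) (≡.sym (g≈g′ a b c)))

firstVertexEquations-unique : ∀ {k V W} → FirstVertexEquations k V → FirstVertexEquations k W →
                              ∀ p d → d ≤ k → V p d ≈ W p d
firstVertexEquations-unique {k} {V} {W} eqV eqW p d d≤k a b c = coeff≡ (<-rec Agree agree c p d d≤k) a b
  where
  module V = FirstVertexEquations eqV
  module W = FirstVertexEquations eqW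

  Agree : ℕ → Set
  Agree c = ∀ p d → d ≤ k → AgreeAt c (V p d) (W p d)

  agree : ∀ c → (∀ {c′} → c′ < c → Agree c′) → Agree c
  agree c below p zero    _   = agreeAt-≈ (V.start p) (W.start p)
    (agreeAt-⊕ (agreeAt-⊕ (agreeAt-⊕ (agreeAt-refl oneS) (agreeAt-T⊗ (λ c′<c → below c′<c p 0 z≤n)))
                          (agreeAt-stoneVar⊗ Left  (agreeAt-T⊗ (λ c′<c → below c′<c Left  k ℕₚ.≤-refl))))
               (agreeAt-stoneVar⊗ Right (agreeAt-T⊗ (λ c′<c → below c′<c Right k ℕₚ.≤-refl))))
  agree c below p (suc d) d<k = agreeAt-≈ (V.step p d d<k) (W.step p d d<k)
    (agreeAt-⊕ (agreeAt-⊕ (agreeAt-refl oneS) (agreeAt-T⊗ (λ c′<c → below c′<c p d (ℕₚ.<⇒≤ d<k))))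
               (agreeAt-stoneVar⊗ p (agreeAt-T⊗ (λ c′<c → below c′<c p k ℕₚ.≤-refl))))

-- The closed-form solution

geomSum : ℕ → PS
geomSum zero    = zeroS
geomSum (suc d) = oneS ⊕ T ⊗ geomSum d

geomSum-snoc : ∀ n → geomSum (suc n) ≈ geomSum n ⊕ T ^S n
geomSum-snoc zero    = solve 1 (λ T → con 1 :+ T :* con 0 := con 0 :+ con 1) ≈-refl T
geomSum-snoc (suc n) = begin
    oneS ⊕ T ⊗ geomSum (suc n)           ≈⟨ ⊕-congˡ oneS (⊗-congˡ T (geomSum-snoc n)) ⟩
    oneS ⊕ T ⊗ (geomSum n ⊕ T ^S n)      ≈⟨ solve 3 (λ T G Tⁿ → con 1 :+ T :* (G :+ Tⁿ)
                                                                := (con 1 :+ T :* G) :+ T :* Tⁿ)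
                                                   ≈-refl T (geomSum n) (T ^S n) ⟩
    geomSum (suc n) ⊕ T ^S suc n         ∎
  where open SetoidReasoning setoid

sumS-distribʳ : ∀ n h D → sumS n (λ j → h j ⊗ D) ≈ sumS n h ⊗ D
sumS-distribʳ zero    h D = ≈-sym (zeroˡ D)
sumS-distribʳ (suc n) h D = ≈-trans (⊕-congʳ (h (suc n) ⊗ D) (sumS-distribʳ n h D))
  (solve 3 (λ S H D → S :* D :+ H :* D := (S :+ H) :* D) ≈-refl (sumS n h) (h (suc n)) D)

sumS-powers : ∀ U n → sumS n (λ j → U ⊗ T ^S j) ≈ U ⊗ T ⊗ geomSum n
sumS-powers U zero    = solve 2 (λ U T → con 0 := U :* T :* con 0) ≈-refl U T
sumS-powers U (suc n) = begin
    sumS n (λ j → U ⊗ T ^S j) ⊕ U ⊗ T ^S suc n  ≈⟨ ⊕-congʳ (U ⊗ T ^S suc n) (sumS-powers U n) ⟩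
    U ⊗ T ⊗ geomSum n ⊕ U ⊗ (T ⊗ T ^S n)       ≈⟨ solve 4 (λ U T G Tⁿ → U :* T :* G :+ U :* (T :* Tⁿ)
                                                                     := U :* T :* (G :+ Tⁿ))
                                                          ≈-refl U T (geomSum n) (T ^S n) ⟩
    U ⊗ T ⊗ (geomSum n ⊕ T ^S n)               ≈⟨ ⊗-congˡ (U ⊗ T) (≈-sym (geomSum-snoc n)) ⟩
    U ⊗ T ⊗ geomSum (suc n)                    ∎
  where open SetoidReasoning setoid

t∣sumS-powers : ∀ U n → t^ 1 ∣ sumS n (λ j → U ⊗ T ^S j)
t∣sumS-powers U zero    = λ _ _ _ _ → ≡.refl
t∣sumS-powers U (suc n) = ∣-⊕ (t∣sumS-powers U n) (∣-⊗ (t^0∣ U) (∣-⊗ t∣T (t^0∣ (T ^S n))))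

denInv-unfold : ∀ k Z → denInv k Z ≈ oneS ⊕ Z ⊗ T ⊗ geomSum k ⊗ denInv k Z
denInv-unfold k Z =
  ≈-trans (geom-unfold (t∣sumS-powers Z k)) (⊕-congˡ oneS (⊗-congʳ (denInv k Z) (sumS-powers Z k)))

module ClosedForm (k : ℕ) where
  open SetoidReasoning setoid

  afterStone : Player → PS
  afterStone p = denInv k (stoneVar p) ⊗ (geomSum k ⊕ T ^S k ⊗ rhsGF k)

  -- Unrolling the step equation d times gives V p d = geomSum d ⊗ (1 + z t V p k) + t^d V p 0
  -- (z = stoneVar p); at d = k, with V p 0 = rhsGF k, this is a linear equation for V p k
  -- whose solution is afterStone p.
  closedForm : Player → ℕ → PS
  closedForm p d = geomSum d ⊗ (oneS ⊕ stoneVar p ⊗ (T ⊗ afterStone p)) ⊕ T ^S d ⊗ rhsGF k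

  closedForm-zero : ∀ p → closedForm p 0 ≈ rhsGF k
  closedForm-zero p = solve 2 (λ S F → con 0 :* S :+ con 1 :* F := F) ≈-refl
                        (oneS ⊕ stoneVar p ⊗ (T ⊗ afterStone p)) (rhsGF k)

  closedForm-suc : ∀ p d → closedForm p (suc d) ≈ oneS ⊕ T ⊗ closedForm p d ⊕ stoneVar p ⊗ (T ⊗ afterStone p)
  closedForm-suc p d =
    solve 6 (λ T G Z A Tᵈ F → (con 1 :+ T :* G) :* (con 1 :+ Z :* (T :* A)) :+ T :* Tᵈ :* F
                              := con 1 :+ T :* (G :* (con 1 :+ Z :* (T :* A)) :+ Tᵈ :* F) :+ Z :* (T :* A))
            ≈-refl T (geomSum d) (stoneVar p) (afterStone p) (T ^S d) (rhsGF k)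

  closedForm-k : ∀ p → closedForm p k ≈ afterStone p
  closedForm-k p = begin
      closedForm p k
    ≈⟨ solve 6 (λ G Z T D Tᵏ F → G :* (con 1 :+ Z :* (T :* (D :* (G :+ Tᵏ :* F)))) :+ Tᵏ :* F
                                 := (con 1 :+ Z :* T :* G :* D) :* (G :+ Tᵏ :* F))
             ≈-refl (geomSum k) (stoneVar p) T (denInv k (stoneVar p)) (T ^S k) (rhsGF k) ⟩
      (oneS ⊕ stoneVar p ⊗ T ⊗ geomSum k ⊗ denInv k (stoneVar p)) ⊗ (geomSum k ⊕ T ^S k ⊗ rhsGF k)
    ≈⟨ ⊗-congʳ (geomSum k ⊕ T ^S k ⊗ rhsGF k) (≈-sym (denInv-unfold k (stoneVar p))) ⟩
      afterStone p
    ∎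

  private
    G  = geomSum k
    Tᵏ = T ^S k
    L  = geom T
    W  = (A k ⊕ B k) ⊗ (Tᵏ ⊗ L)
    M  = geom W
    E  = sumS k (λ j → X ⊗ T ^S j ⊗ denInv k X) ⊕ sumS k (λ j → Y ⊗ T ^S j ⊗ denInv k Y) ⊕ oneS

    stoneSum : ∀ Z → sumS k (λ j → Z ⊗ T ^S j ⊗ denInv k Z) ≈ Z ⊗ T ⊗ G ⊗ denInv k Z
    stoneSum Z = ≈-trans (sumS-distribʳ k (λ j → Z ⊗ T ^S j) (denInv k Z))
                         (⊗-congʳ (denInv k Z) (sumS-powers Z k))

    t∣W : t^ 1 ∣ W
    t∣W = ∣-⊗ (∣-⊕ (∣-⊗ (∣-⊗ (t^0∣ X) t∣T) (t^0∣ (denInv k X)))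
                   (∣-⊗ (∣-⊗ (t^0∣ Y) t∣T) (t^0∣ (denInv k Y))))
              (t^0∣ (Tᵏ ⊗ L))

  rhsGF-unfold : rhsGF k ≈ oneS ⊕ T ⊗ rhsGF k ⊕ X ⊗ (T ⊗ afterStone Left) ⊕ Y ⊗ (T ⊗ afterStone Right)
  rhsGF-unfold = begin
      L ⊗ M ⊗ E
    ≈⟨ ⊗-congʳ E (⊗-congʳ M (geom-unfold t∣T)) ⟩
      (oneS ⊕ T ⊗ L) ⊗ M ⊗ E
    ≈⟨ solve 4 (λ T L M E → (con 1 :+ T :* L) :* M :* E := M :* E :+ T :* (L :* M :* E)) ≈-refl T L M E ⟩
      M ⊗ E ⊕ T ⊗ rhsGF k
    ≈⟨ ⊕-congʳ (T ⊗ rhsGF k) (⊗-congʳ E (geom-unfold t∣W)) ⟩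
      (oneS ⊕ W ⊗ M) ⊗ E ⊕ T ⊗ rhsGF k
    ≈⟨ solve 4 (λ W M E TF → (con 1 :+ W :* M) :* E :+ TF := E :+ W :* (M :* E) :+ TF)
               ≈-refl W M E (T ⊗ rhsGF k) ⟩
      E ⊕ W ⊗ (M ⊗ E) ⊕ T ⊗ rhsGF k
    ≈⟨ ⊕-congʳ (T ⊗ rhsGF k) (⊕-congʳ (W ⊗ (M ⊗ E)) (⊕-congʳ oneS (+-cong (stoneSum X) (stoneSum Y)))) ⟩
      X ⊗ T ⊗ G ⊗ denInv k X ⊕ Y ⊗ T ⊗ G ⊗ denInv k Y ⊕ oneS ⊕ W ⊗ (M ⊗ E) ⊕ T ⊗ rhsGF k
    ≈⟨ solve 10 (λ X Y T G Dx Dy Tᵏ L M E →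
          X :* T :* G :* Dx :+ Y :* T :* G :* Dy :+ con 1 :+ (X :* T :* Dx :+ Y :* T :* Dy) :* (Tᵏ :* L) :* (M :* E)
            :+ T :* (L :* M :* E)
          := con 1 :+ T :* (L :* M :* E) :+ X :* (T :* (Dx :* (G :+ Tᵏ :* (L :* M :* E))))
             :+ Y :* (T :* (Dy :* (G :+ Tᵏ :* (L :* M :* E)))))
        ≈-refl X Y T G (denInv k X) (denInv k Y) Tᵏ L M E ⟩
      oneS ⊕ T ⊗ rhsGF k ⊕ X ⊗ (T ⊗ afterStone Left) ⊕ Y ⊗ (T ⊗ afterStone Right)
    ∎

  closedForm-equations : FirstVertexEquations k closedForm
  closedForm-equations = record
    { start = λ p → begin
        closedForm p 0
      ≈⟨ closedForm-zero p ⟩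
        rhsGF k
      ≈⟨ rhsGF-unfold ⟩
        oneS ⊕ T ⊗ rhsGF k ⊕ X ⊗ (T ⊗ afterStone Left) ⊕ Y ⊗ (T ⊗ afterStone Right)
      ≈˘⟨ +-cong (+-cong (⊕-congˡ oneS (⊗-congˡ T (closedForm-zero p)))
                         (⊗-congˡ X (⊗-congˡ T (closedForm-k Left))))
                 (⊗-congˡ Y (⊗-congˡ T (closedForm-k Right))) ⟩
        oneS ⊕ T ⊗ closedForm p 0 ⊕ X ⊗ (T ⊗ closedForm Left k) ⊕ Y ⊗ (T ⊗ closedForm Right k)
      ∎
    ; step = λ p d _ → ≈-trans (closedForm-suc p d)
               (⊕-congˡ (oneS ⊕ T ⊗ closedForm p d)
                        (⊗-congˡ (stoneVar p) (⊗-congˡ T (≈-sym (closedForm-k p)))))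
    }

-- Positions of EnSnort(k) on paths

Property : Set
Property = ∀ {n} → Vec Colour n → Bool

infixl 5 _after_
_after_ : Property → Colour → Property
(P after c) w = P (c ∷ w)

indicator : Bool → ℕ
indicator s = if s then 1 else 0

matches : Property → ℕ → ℕ → ∀ {n} → Vec Colour n → ℕ
matches P a b v = indicator (P v ∧ (countC isBlue v ≡ᵇ a) ∧ (countC isRed v ≡ᵇ b))

gf : Property → PS
gf P a b c = + sum (map (matches P a b) (allAssignments c))

gf-cong : ∀ {P Q : Property} → (∀ {n} (w : Vec Colour n) → P w ≡ Q w) → gf P ≈ gf Q
gf-cong P≡Q a b c =
  cong (λ xs → + sum xs) (map-cong (λ w → cong (λ s → indicator (s ∧ _)) (P≡Q w)) (allAssignments c))

sum-map-zero : ∀ {A : Set} {f : A → ℕ} xs → (∀ x → f x ≡ 0) → sum (map f xs) ≡ 0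
sum-map-zero []       f≡0 = ≡.refl
sum-map-zero (x ∷ xs) f≡0 = cong₂ _+ℕ_ (f≡0 x) (sum-map-zero xs f≡0)

gf-never : gf (λ _ → false) ≈ zeroS
gf-never a b c = cong +_ (sum-map-zero (allAssignments c) (λ _ → ≡.refl))

sum-map-++ : ∀ {A : Set} (f : A → ℕ) xs ys → sum (map f (xs ++ ys)) ≡ sum (map f xs) +ℕ sum (map f ys)
sum-map-++ f xs ys = ≡.trans (cong sum (map-++ f xs ys)) (sum-++ (map f xs) (map f ys))

sum-allAssignments-suc : ∀ n (f : Vec Colour (suc n) → ℕ) →
  sum (map f (allAssignments (suc n))) ≡
  sum (map (λ w → f (empty ∷ w)) (allAssignments n)) +ℕ sum (map (λ w → f (blue ∷ w)) (allAssignments n))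
    +ℕ sum (map (λ w → f (red ∷ w)) (allAssignments n))
sum-allAssignments-suc n f = begin
    sum (map f (map (empty ∷_) vs ++ map (blue ∷_) vs ++ map (red ∷_) vs ++ []))
  ≡⟨ sum-map-++ f (map (empty ∷_) vs) _ ⟩
    sumOver empty +ℕ sum (map f (map (blue ∷_) vs ++ map (red ∷_) vs ++ []))
  ≡⟨ cong (sumOver empty +ℕ_) (sum-map-++ f (map (blue ∷_) vs) _) ⟩
    sumOver empty +ℕ (sumOver blue +ℕ sum (map f (map (red ∷_) vs ++ [])))
  ≡⟨ cong (λ s → sumOver empty +ℕ (sumOver blue +ℕ s))
       (≡.trans (sum-map-++ f (map (red ∷_) vs) []) (ℕₚ.+-identityʳ _)) ⟩
    sumOver empty +ℕ (sumOver blue +ℕ sumOver red)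
  ≡⟨ ≡.sym (ℕₚ.+-assoc (sumOver empty) _ _) ⟩
    sumOver empty +ℕ sumOver blue +ℕ sumOver red
  ≡⟨ cong₂ _+ℕ_ (cong₂ _+ℕ_ (prefix empty) (prefix blue)) (prefix red) ⟩
    sum (map (λ w → f (empty ∷ w)) vs) +ℕ sum (map (λ w → f (blue ∷ w)) vs)
      +ℕ sum (map (λ w → f (red ∷ w)) vs)
  ∎
  where
  open ≡.≡-Reasoning
  vs = allAssignments n
  sumOver : Colour → ℕ
  sumOver c = sum (map f (map (c ∷_) vs))
  prefix : ∀ c → sumOver c ≡ sum (map (λ w → f (c ∷ w)) vs)
  prefix c = cong sum (≡.sym (map-∘ vs))

gf-suc : ∀ (P : Property) a b n → gf P a b (suc n) ≡
         gf (P after empty) a b n +ℤ xShift (gf (P after blue)) a b n +ℤ yShift (gf (P after red)) a b n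
gf-suc P a b n =
  ≡.trans (cong +_ (sum-allAssignments-suc n (matches P a b)))
          (cong₂ _+ℤ_ (cong (gf (P after empty) a b n +ℤ_) (blueFirst a)) (redFirst b))
  where
  vs = allAssignments n
  blueFirst : ∀ a → + sum (map (λ w → matches P a b (blue ∷ w)) vs) ≡ xShift (gf (P after blue)) a b n
  blueFirst zero    = cong +_ (sum-map-zero vs (λ w → cong indicator (∧-zeroʳ (P (blue ∷ w)))))
  blueFirst (suc a) = ≡.refl
  redFirst : ∀ b → + sum (map (λ w → matches P a b (red ∷ w)) vs) ≡ yShift (gf (P after red)) a b n
  redFirst zero    = cong +_ (sum-map-zero vs (λ w → cong indicator
                       (≡.trans (cong (P (red ∷ w) ∧_) (∧-zeroʳ _)) (∧-zeroʳ (P (red ∷ w))))))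
  redFirst (suc b) = ≡.refl

oneS-suc : ∀ a b c → oneS a b (suc c) ≡ + 0
oneS-suc zero    zero    c = ≡.refl
oneS-suc zero    (suc b) c = ≡.refl
oneS-suc (suc a) b       c = ≡.refl

gf-unfold : ∀ (P : Property) → P [] ≡ true →
            gf P ≈ oneS ⊕ tShift (gf (P after empty) ⊕ xShift (gf (P after blue)) ⊕ yShift (gf (P after red)))
gf-unfold P P[] a b zero    rewrite P[] = emptyColouring a b
  where
  emptyColouring : ∀ a b → + (matches (λ _ → true) a b [] +ℕ 0) ≡ oneS a b 0 +ℤ + 0
  emptyColouring zero    zero    = ≡.refl
  emptyColouring zero    (suc b) = ≡.refl
  emptyColouring (suc a) b       = ≡.refl
gf-unfold P P[] a b (suc n) =
  ≡.trans (gf-suc P a b n) (≡.sym (≡.trans (cong (_+ℤ rest) (oneS-suc a b n)) (ℤₚ.+-identityˡ rest)))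
  where
  rest = (gf (P after empty) ⊕ xShift (gf (P after blue)) ⊕ yShift (gf (P after red))) a b n

gf-firstVertex : ∀ (P : Property) → P [] ≡ true →
  gf P ≈ oneS ⊕ T ⊗ gf (P after empty) ⊕ X ⊗ (T ⊗ gf (P after blue)) ⊕ Y ⊗ (T ⊗ gf (P after red))
gf-firstVertex P P[] = begin
    gf P
  ≈⟨ gf-unfold P P[] ⟩
    oneS ⊕ tShift (g₀ ⊕ xShift gᵇ ⊕ yShift gʳ)
  ≈˘⟨ ⊕-congˡ oneS (≈-trans (T-⊗ (g₀ ⊕ X ⊗ gᵇ ⊕ Y ⊗ gʳ))
                      (λ a b → ℤ⟦t⟧.shift-cong (+-cong (⊕-congˡ g₀ (X-⊗ gᵇ)) (Y-⊗ gʳ) a b))) ⟩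
    oneS ⊕ T ⊗ (g₀ ⊕ X ⊗ gᵇ ⊕ Y ⊗ gʳ)
  ≈⟨ solve 6 (λ T X Y g₀ gᵇ gʳ → con 1 :+ T :* (g₀ :+ X :* gᵇ :+ Y :* gʳ)
                                 := con 1 :+ T :* g₀ :+ X :* (T :* gᵇ) :+ Y :* (T :* gʳ))
           ≈-refl T X Y g₀ gᵇ gʳ ⟩
    oneS ⊕ T ⊗ g₀ ⊕ X ⊗ (T ⊗ gᵇ) ⊕ Y ⊗ (T ⊗ gʳ)
  ∎
  where
  open SetoidReasoning setoid
  g₀ gᵇ gʳ : PS
  g₀ = gf (P after empty)
  gᵇ = gf (P after blue)
  gʳ = gf (P after red)

allFinᵇ : (n : ℕ) → (Fin n → Bool) → Bool
allFinᵇ zero    g = true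
allFinᵇ (suc n) g = g fzero ∧ allFinᵇ n (λ i → g (fsuc i))

allFinᵇ-cong : ∀ n {g h : Fin n → Bool} → (∀ i → g i ≡ h i) → allFinᵇ n g ≡ allFinᵇ n h
allFinᵇ-cong zero    g≡h = ≡.refl
allFinᵇ-cong (suc n) g≡h = cong₂ _∧_ (g≡h fzero) (allFinᵇ-cong n (λ i → g≡h (fsuc i)))

allB-tabulate : ∀ {A : Set} n (p : A → Bool) (f : Fin n → A) → allB p (tabulate f) ≡ allFinᵇ n (λ i → p (f i))
allB-tabulate zero    p f = ≡.refl
allB-tabulate (suc n) p f = cong (p (f fzero) ∧_) (allB-tabulate n p (λ i → f (fsuc i)))

isPosition≡allFinᵇ : ∀ G n v → isPosition G n v ≡
  allFinᵇ n (λ i → allFinᵇ n (λ j →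
    if toℕ i <ᵇ toℕ j then pairOK G ∣ toℕ i - toℕ j ∣ (lookup v i) (lookup v j) else true))
isPosition≡allFinᵇ G n v =
  ≡.trans (allB-tabulate n _ (λ i → i)) (allFinᵇ-cong n (λ i → allB-tabulate n _ (λ j → j)))

firstRow : DistanceGame → Colour → Property
firstRow G c {m} w = allFinᵇ m (λ j → pairOK G (suc (toℕ j)) c (lookup w j))

isPosition-∷ : ∀ G m c (w : Vec Colour m) → isPosition G (suc m) (c ∷ w) ≡ firstRow G c w ∧ isPosition G m w
isPosition-∷ G m c w =
  ≡.trans (isPosition≡allFinᵇ G (suc m) (c ∷ w))
          (cong (firstRow G c w ∧_) (≡.sym (isPosition≡allFinᵇ G m w)))

conflicts : Colour → Colour → Bool
conflicts blue red  = true
conflicts red  blue = true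
conflicts _    _    = false

pairOK-EnSnort : ∀ k t c y → pairOK (EnSnort k) (suc t) c y ≡ not (conflicts c y ∧ (t <ᵇ k))
pairOK-EnSnort k t empty y     = ≡.refl
pairOK-EnSnort k t blue  empty = ≡.refl
pairOK-EnSnort k t blue  blue  = ≡.refl
pairOK-EnSnort k t blue  red   = ≡.refl
pairOK-EnSnort k t red   empty = ≡.refl
pairOK-EnSnort k t red   blue  = ≡.refl
pairOK-EnSnort k t red   red   = ≡.refl

compatible : Colour → ℕ → Property
compatible c zero    w       = true
compatible c (suc d) []      = true
compatible c (suc d) (y ∷ w) = not (conflicts c y) ∧ compatible c d w

firstRow-EnSnort : ∀ k c {m} (w : Vec Colour m) → firstRow (EnSnort k) c w ≡ compatible c k w
firstRow-EnSnort zero    c {m} w       =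
  allFinᵇ-true m (λ j → ≡.trans (pairOK-EnSnort 0 (toℕ j) c (lookup w j)) (cong not (∧-zeroʳ _)))
  where
  allFinᵇ-true : ∀ n {g : Fin n → Bool} → (∀ i → g i ≡ true) → allFinᵇ n g ≡ true
  allFinᵇ-true zero    _      = ≡.refl
  allFinᵇ-true (suc n) g≡true = cong₂ _∧_ (g≡true fzero) (allFinᵇ-true n (λ i → g≡true (fsuc i)))
firstRow-EnSnort (suc k) c     []      = ≡.refl
firstRow-EnSnort (suc k) c     (y ∷ w) = cong₂ _∧_
  (≡.trans (pairOK-EnSnort (suc k) 0 c y) (cong not (∧-identityʳ _)))
  (≡.trans (allFinᵇ-cong _ (λ j → ≡.trans (pairOK-EnSnort (suc k) (suc (toℕ j)) c (lookup w j))
                                          (≡.sym (pairOK-EnSnort k (toℕ j) c (lookup w j)))))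
           (firstRow-EnSnort k c w))

compatible-empty : ∀ d {m} (w : Vec Colour m) → compatible empty d w ≡ true
compatible-empty zero    w       = ≡.refl
compatible-empty (suc d) []      = ≡.refl
compatible-empty (suc d) (y ∷ w) = compatible-empty d w

compatible-absorb : ∀ c {d e} {m} (w : Vec Colour m) → d ≤ e →
                    compatible c d w ∧ compatible c e w ≡ compatible c e w
compatible-absorb c {zero}              w       _         = ≡.refl
compatible-absorb c {suc d} {suc e}     []      _         = ≡.refl
compatible-absorb c {suc d} {suc e}     (y ∷ w) (s≤s d≤e) with not (conflicts c y)
... | true  = compatible-absorb c w d≤e
... | false = ≡.refl

stone : Player → Colour
stone Left  = blue
stone Right = red

opponent : Player → Player
opponent Left  = Right
opponent Right = Left

-- the positions that may follow a stone of p after k − d empty vertices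
follower : ℕ → Player → ℕ → Property
follower k p d {n} w = compatible (stone p) d w ∧ isPosition (EnSnort k) n w

isPosition-EnSnort-∷ : ∀ k c {m} (w : Vec Colour m) →
                       isPosition (EnSnort k) (suc m) (c ∷ w) ≡ compatible c k w ∧ isPosition (EnSnort k) m w
isPosition-EnSnort-∷ k c {m} w = ≡.trans (isPosition-∷ (EnSnort k) m c w) (cong (_∧ _) (firstRow-EnSnort k c w))

follower-[] : ∀ k p d → follower k p d [] ≡ true
follower-[] k p zero    = ≡.refl
follower-[] k p (suc d) = ≡.refl

follower₀-after : ∀ k p c {m} (w : Vec Colour m) → (follower k p 0 after c) w ≡ compatible c k w ∧ follower k p 0 w
follower₀-after k p c w = isPosition-EnSnort-∷ k c w

conflicts-empty : ∀ c → conflicts c empty ≡ false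
conflicts-empty empty = ≡.refl
conflicts-empty blue  = ≡.refl
conflicts-empty red   = ≡.refl

follower-after-empty : ∀ k p d {m} (w : Vec Colour m) → (follower k p (suc d) after empty) w ≡ follower k p d w
follower-after-empty k p d {m} w = cong₂ _∧_
  (cong (λ s → not s ∧ compatible (stone p) d w) (conflicts-empty (stone p)))
  (≡.trans (isPosition-EnSnort-∷ k empty w) (cong (_∧ isPosition (EnSnort k) m w) (compatible-empty k w)))

follower-after-own : ∀ k p d {m} (w : Vec Colour m) → d ≤ k →
                     (follower k p (suc d) after stone p) w ≡ follower k p k w
follower-after-own k p d {m} w d≤k = begin
    (not (conflicts (stone p) (stone p)) ∧ compatible (stone p) d w) ∧ isPosition (EnSnort k) (suc m) (stone p ∷ w)
  ≡⟨ cong₂ _∧_ (cong (λ s → not s ∧ compatible (stone p) d w) (no-self-conflict p))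
               (isPosition-EnSnort-∷ k (stone p) w) ⟩
    compatible (stone p) d w ∧ (compatible (stone p) k w ∧ isPosition (EnSnort k) m w)
  ≡⟨ ≡.sym (∧-assoc (compatible (stone p) d w) _ _) ⟩
    (compatible (stone p) d w ∧ compatible (stone p) k w) ∧ isPosition (EnSnort k) m w
  ≡⟨ cong (_∧ isPosition (EnSnort k) m w) (compatible-absorb (stone p) w d≤k) ⟩
    follower k p k w
  ∎
  where
  open ≡.≡-Reasoning
  no-self-conflict : ∀ p → conflicts (stone p) (stone p) ≡ false
  no-self-conflict Left  = ≡.refl
  no-self-conflict Right = ≡.refl

follower-after-opponent : ∀ k p d {m} (w : Vec Colour m) → (follower k p (suc d) after stone (opponent p)) w ≡ false
follower-after-opponent k Left  d w = ≡.refl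
follower-after-opponent k Right d w = ≡.refl

followerGF : ℕ → Player → ℕ → PS
followerGF k p d = gf (follower k p d)

stoneTerms : ∀ p (g : Colour → PS) → g (stone (opponent p)) ≈ zeroS →
             X ⊗ (T ⊗ g blue) ⊕ Y ⊗ (T ⊗ g red) ≈ stoneVar p ⊗ (T ⊗ g (stone p))
stoneTerms Left  g g≈0 = ≈-trans (⊕-congˡ (X ⊗ (T ⊗ g blue)) (⊗-congˡ Y (⊗-congˡ T g≈0)))
  (solve 4 (λ X Y T B → X :* (T :* B) :+ Y :* (T :* con 0) := X :* (T :* B)) ≈-refl X Y T (g blue))
stoneTerms Right g g≈0 = ≈-trans (⊕-congʳ (Y ⊗ (T ⊗ g red)) (⊗-congˡ X (⊗-congˡ T g≈0)))
  (solve 4 (λ X Y T R → X :* (T :* con 0) :+ Y :* (T :* R) := Y :* (T :* R)) ≈-refl X Y T (g red))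

followerGF-equations : ∀ k → FirstVertexEquations k (followerGF k)
followerGF-equations k = record { start = start ; step = step }
  where
  start : ∀ p → followerGF k p 0 ≈ oneS ⊕ T ⊗ followerGF k p 0 ⊕ X ⊗ (T ⊗ followerGF k Left k)
                                        ⊕ Y ⊗ (T ⊗ followerGF k Right k)
  start p = ≈-trans (gf-firstVertex (follower k p 0) (follower-[] k p 0))
    (+-cong (+-cong (⊕-congˡ oneS (⊗-congˡ T (gf-cong afterEmpty)))
                    (⊗-congˡ X (⊗-congˡ T (gf-cong (follower₀-after k p blue)))))
            (⊗-congˡ Y (⊗-congˡ T (gf-cong (follower₀-after k p red)))))
    where
    afterEmpty : ∀ {m} (w : Vec Colour m) → (follower k p 0 after empty) w ≡ follower k p 0 w
    afterEmpty w = ≡.trans (follower₀-after k p empty w) (cong (_∧ follower k p 0 w) (compatible-empty k w))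

  step : ∀ p d → d < k →
         followerGF k p (suc d) ≈ oneS ⊕ T ⊗ followerGF k p d ⊕ stoneVar p ⊗ (T ⊗ followerGF k p k)
  step p d d<k = begin
      gf P
    ≈⟨ gf-firstVertex P (follower-[] k p (suc d)) ⟩
      oneS ⊕ T ⊗ gf (P after empty) ⊕ X ⊗ (T ⊗ gf (P after blue)) ⊕ Y ⊗ (T ⊗ gf (P after red))
    ≈⟨ +-assoc (oneS ⊕ T ⊗ gf (P after empty)) _ _ ⟩
      oneS ⊕ T ⊗ gf (P after empty) ⊕ (X ⊗ (T ⊗ gf (P after blue)) ⊕ Y ⊗ (T ⊗ gf (P after red)))
    ≈⟨ +-cong (⊕-congˡ oneS (⊗-congˡ T (gf-cong (follower-after-empty k p d))))
              (stoneTerms p (λ c → gf (P after c)) (≈-trans (gf-cong (follower-after-opponent k p d)) gf-never)) ⟩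
      oneS ⊕ T ⊗ followerGF k p d ⊕ stoneVar p ⊗ (T ⊗ gf (P after stone p))
    ≈⟨ ⊕-congˡ (oneS ⊕ T ⊗ followerGF k p d)
         (⊗-congˡ (stoneVar p) (⊗-congˡ T (gf-cong (λ w → follower-after-own k p d w (ℕₚ.<⇒≤ d<k))))) ⟩
      oneS ⊕ T ⊗ followerGF k p d ⊕ stoneVar p ⊗ (T ⊗ followerGF k p k)
    ∎
    where
    open SetoidReasoning setoid
    P = follower k p (suc d)

-- The identity also holds for k = 0.
mainTheorem3 : (k : ℕ) → 1 ≤ k → profileGF (EnSnort k) ≈ rhsGF k
mainTheorem3 k _ = begin
    profileGF (EnSnort k)   ≡⟨⟩
    followerGF k Left 0     ≈⟨ firstVertexEquations-unique (followerGF-equations k) closedForm-equations Left 0 z≤n ⟩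
    closedForm Left 0       ≈⟨ closedForm-zero Left ⟩
    rhsGF k                 ∎
  where
  open SetoidReasoning setoid
  open ClosedForm k
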